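{- Let $\mathfrak{S}$ and $\mathfrak{S}'$ be the following models. Let $4Tup := \{(a,b,c,d)^+, (a,b,c,d)^- \mid a,b,c,d \in \{0,1\}\}$. $\mathfrak{S}$: moments $\{\dag\}\cup 4Tup$ with $\dag$ below every element of $4Tup$ (and no other strict order); histories $h_m = \{\dag,m\}$, $m\in 4Tup$; at $\dag$, for $1\le j\le 4$, $Choice^\dag_j = \{\{h_m : pr_j(m)=0\},\{h_m: pr_j(m)=1\}\}$; at $m\in 4Tup$ choices are trivial; $V(p) = \{(\dag,h_m): pr_1(m)=0\}$, $V(q) = \{(\dag,h_m): (pr_1(m)=pr_2(m)=0) \vee (pr_3(m)=pr_4(m)=0) \vee sign(m)=+\}$. $\mathfrak{S}'$: moments $\{\ddag\}\cup 4Tup$ with $\ddag$ below every element of $4Tup$; histories $g_m=\{\ddag,m\}$; $Choice'^\ddag_j = \{\{g_m : pr_j(m)=0\},\{g_m: pr_j(m)=1\}\}$; trivial choices at $m\in4Tup$; $V'(q) = \{(\ddag,g_m): (pr_3(m)=pr_4(m)=0)\vee(sign(m)=+ \,\&\, (pr_3(m)\neq 1 \vee pr_4(m)\neq 0))\}$, $V'(r) = \{(\ddag,g_m): pr_3(m)=1\}$. Then for all $m \in 4Tup$: $\mathfrak{S},\dag,h_m \models \Diamond([1]p \wedge [2](p\to q))$ and $\mathfrak{S}',\ddag,g_m \models \Diamond([3]r \wedge [4](r \to \neg q))$.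
   Context: For $m = (a_1,a_2,a_3,a_4)^{s}\in 4Tup$, $pr_j(m) = a_j$ and $sign(m) = s$. These are stit models: histories are maximal chains, $H_m$ is the set of histories through $m$, $Choice^m_j$ is a partition of $H_m$ with $Choice^m_j(h)$ the cell containing $h$. Satisfaction at moment-history pairs: $\models p$ iff $(m,h)\in V(p)$; Boolean clauses as usual; $m,h\models[j]A$ iff $m,h'\models A$ for all $h'\in Choice^m_j(h)$; $m,h\models\Box A$ iff $m,h'\models A$ for all $h'\in H_m$; $\Diamond A := \neg\Box\neg A$. -}

module Defs where

open import Data.Bool using (Bool; true; false)
open import Data.Fin using (Fin; zero; suc)
open import Data.Product using (_×_; Σ)
open import Data.Sum using (_⊎_)
open import Data.Empty using (⊥)
open import Data.Unit using (⊤)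
open import Relation.Nullary using (¬_)
open import Relation.Binary.PropositionalEquality using (_≡_)

-- Bits {0,1}: false = 0, true = 1.
data Sign : Set where
  plus minus : Sign

record Tup : Set where
  constructor tup
  field
    a1 a2 a3 a4 : Bool
    sign : Sign
open Tup public

-- Agents 1..4 are represented by Fin 4 (zero = agent 1, …).
Agent : Set
Agent = Fin 4

pr : Agent → Tup → Bool
pr zero m = a1 m
pr (suc zero) m = a2 m
pr (suc (suc zero)) m = a3 m
pr (suc (suc (suc zero))) m = a4 m

agent1 agent2 agent3 agent4 : Agent
agent1 = zero
agent2 = suc zero
agent3 = suc (suc zero)
agent4 = suc (suc (suc zero))

data Atom : Set where
  p q r : Atom

data Form : Set where
  atom : Atom → Form
  ¬′_ : Form → Form
  _∧′_ : Form → Form → Form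
  _⇒_ : Form → Form → Form
  [_]_ : Agent → Form → Form
  □_ : Form → Form

◇_ : Form → Form
◇ A = ¬′ (□ (¬′ A))

-- A (pointed-at) stit model: moments, histories, the relation h ∈ H_m,
-- choice cells (Choice m j h h' means h' ∈ Choice^m_j(h)), valuation.
record StitModel : Set₁ where
  field
    Moment : Set
    History : Set
    _∈H_ : History → Moment → Set
    Choice : Moment → Agent → History → History → Set
    V : Atom → Moment → History → Set

module _ (M : StitModel) where
  open StitModel M
  Sat : Moment → History → Form → Set
  Sat m h (atom x) = V x m h
  Sat m h (¬′ A) = ¬ Sat m h A
  Sat m h (A ∧′ B) = Sat m h A × Sat m h B
  Sat m h (A ⇒ B) = Sat m h A → Sat m h B
  Sat m h ([ j ] A) = ∀ h' → Choice m j h h' → Sat m h' A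
  Sat m h (□ A) = ∀ h' → h' ∈H m → Sat m h' A

-- The common frame: moments {root} ∪ 4Tup, root below every tuple.
-- Histories h_m = {root, m} are indexed by m ∈ 4Tup.
data Mom : Set where
  root : Mom
  at : Tup → Mom

_∈H₀_ : Tup → Mom → Set
h ∈H₀ root = ⊤
h ∈H₀ at m = h ≡ m

Choice₀ : Mom → Agent → Tup → Tup → Set
Choice₀ root j h h' = pr j h ≡ pr j h'
Choice₀ (at m) j h h' = h' ≡ m

-- Valuation of 𝔖 (V(r) is unspecified in the paper; taken empty).
V𝔖 : Atom → Mom → Tup → Set
V𝔖 p root h = a1 h ≡ false
V𝔖 q root h = (a1 h ≡ false × a2 h ≡ false) ⊎ (a3 h ≡ false × a4 h ≡ false) ⊎ sign h ≡ plus
V𝔖 r root h = ⊥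
V𝔖 _ (at _) h = ⊥

-- Valuation of 𝔖' (V'(p) is unspecified in the paper; taken empty).
V𝔖′ : Atom → Mom → Tup → Set
V𝔖′ p root h = ⊥
V𝔖′ q root h = (a3 h ≡ false × a4 h ≡ false) ⊎ (sign h ≡ plus × (¬ (a3 h ≡ true) ⊎ ¬ (a4 h ≡ false)))
V𝔖′ r root h = a3 h ≡ true
V𝔖′ _ (at _) h = ⊥

𝔖 : StitModel
𝔖 = record { Moment = Mom ; History = Tup ; _∈H_ = _∈H₀_ ; Choice = Choice₀ ; V = V𝔖 }

𝔖′ : StitModel
𝔖′ = record { Moment = Mom ; History = Tup ; _∈H_ = _∈H₀_ ; Choice = Choice₀ ; V = V𝔖′ }

module Submission where

open import Defs
open import Data.Bool using (true; false)
open import Data.Product using (_×_; _,_)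
open import Data.Sum using (inj₁; inj₂)
open import Data.Unit using (tt)
open import Relation.Binary.PropositionalEquality using (_≡_; sym; trans)
open import Relation.Nullary using (¬_)

tupleModel : (Atom → Mom → Tup → Set) → StitModel
tupleModel V = record { Moment = Mom ; History = Tup ; _∈H_ = _∈H₀_ ; Choice = Choice₀ ; V = V }

-- Every history passes through the root, so one witness history settles ◇ there.
◇-root-intro : ∀ V A (m w : Tup) → Sat (tupleModel V) root w A → Sat (tupleModel V) root m (◇ A)
◇-root-intro V A m w sat-w ¬A-everywhere = ¬A-everywhere w tt sat-w

[1]p∧[2]p⇒q [3]r∧[4]r⇒¬q : Form
[1]p∧[2]p⇒q = ([ agent1 ] atom p) ∧′ ([ agent2 ] (atom p ⇒ atom q))
[3]r∧[4]r⇒¬q = ([ agent3 ] atom r) ∧′ ([ agent4 ] (atom r ⇒ (¬′ atom q)))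

0000⁺ 0010⁺ : Tup
0000⁺ = tup false false false false plus
0010⁺ = tup false false true false plus

-- Agent 2's cell keeps a2 = 0, so wherever p (a1 = 0) holds, so does q.
sat-𝔖-0000⁺ : Sat 𝔖 root 0000⁺ [1]p∧[2]p⇒q
sat-𝔖-0000⁺ = (λ _ a1≡0 → sym a1≡0) , λ _ a2≡0 a1≡0 → inj₁ (a1≡0 , sym a2≡0)

-- Agent 4's cell keeps a4 = 0, which together with r (a3 = 1) defeats every disjunct of q.
sat-𝔖′-0010⁺ : Sat 𝔖′ root 0010⁺ [3]r∧[4]r⇒¬q
sat-𝔖′-0010⁺ = (λ _ a3≡1 → sym a3≡1) , ¬q
  where
  ¬q : ∀ h → false ≡ a4 h → a3 h ≡ true → ¬ V𝔖′ q root h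
  ¬q _ _    a3≡1 (inj₁ (a3≡0 , _)) with () ← trans (sym a3≡1) a3≡0
  ¬q _ _    a3≡1 (inj₂ (_ , inj₁ a3≢1)) = a3≢1 a3≡1
  ¬q _ a4≡0 _    (inj₂ (_ , inj₂ a4≢0)) = a4≢0 (sym a4≡0)

lemma13 : (m : Tup) →
    Sat 𝔖 root m (◇ (([ agent1 ] atom p) ∧′ ([ agent2 ] (atom p ⇒ atom q))))
    × Sat 𝔖′ root m (◇ (([ agent3 ] atom r) ∧′ ([ agent4 ] (atom r ⇒ (¬′ atom q)))))
lemma13 m =
    ◇-root-intro V𝔖 [1]p∧[2]p⇒q m 0000⁺ sat-𝔖-0000⁺
  , ◇-root-intro V𝔖′ [3]r∧[4]r⇒¬q m 0010⁺ sat-𝔖′-0010⁺
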